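{- Let $T$ be a commutative monad on a cartesian monoidal category $\mathbb C$, let $R$ be a monoid in $\mathbb C$, and let $S=TR$ with its induced monoid structure and algebra structure $s=\mu_R:TS\to S$. If the family of morphisms $$TTX\xrightarrow{T(\varepsilon_{h_1}\cdots\varepsilon_{h_n})}TS\xrightarrow{s}S,$$ indexed by $n\in\mathbb N$ and $h_1,\dots,h_n:X\to S$, is jointly monic for every object $X$, then $T$ is $R$-observational (hence observational).
   Context: $\nabla_{A,B}:TA\times TB\to T(A\times B)$ is the monoidal structure of the commutative monad. If $R$ has unit $e^R:1\to R$ and multiplication $m^R:R\times R\to R$, then $S=TR$ is a monoid with unit $T(e^R)\circ\eta_1$ and multiplication $T(m^R)\circ\nabla_{R,R}$; $m_n^S:S^n\to S$ denotes $n$-fold multiplication ($m_0^S$ the unit, $m_1^S=1$). For $h:X\to S$, $\varepsilon_h=s\circ Th:TX\to S$. For $g_1,\dots,g_n:Y\to S$, the pointwise product $g_1\cdots g_n$ is $m_n^S\circ(g_1\times\cdots\times g_n)\circ\Delta_n:Y\to S$ ($\Delta_n$ the $n$-fold diagonal). Kleisli morphisms $f:A\rightsquigarrow B$ correspond to $f^\sharp:A\to TB$ ($h^\flat$ denotes the Kleisli morphism of $h:A\to TB$), composition $(g\circledcirc f)^\sharp=\mu\circ Tg^\sharp\circ f^\sharp$; $\mathsf{Kl}(T)$ is monoidal with $A\otimes B=A\times B$, $(f\otimes g)^\sharp=\nabla\circ(f^\sharp\times g^\sharp)$; $(\mathsf{copy}_X)^\sharp=\eta\circ\Delta$, $(\mathsf{del}_X)^\sharp=\eta\circ!$;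 $\mathsf{copy}_n$ is the iterated copy ($\mathsf{copy}_0=\mathsf{del}$); $(\mathsf{force}_X)^\sharp=1_{TX}$; $\mathsf{samp}_n=\mathsf{force}^{\otimes n}\circledcirc\mathsf{copy}_n:TX\rightsquigarrow X^{\otimes n}$. $T$ is observational if for every $X$ the family $(\mathsf{samp}_n)_{n\in\mathbb N}$ is jointly monic in $\mathsf{Kl}(T)$; $T$ is $R$-observational if for every $X$ the family $(h_1^\flat\otimes\cdots\otimes h_n^\flat)\circledcirc\mathsf{samp}_n:TX\rightsquigarrow R^{\otimes n}$, over $n\in\mathbb N$ and $h_1,\dots,h_n:X\to TR$, is jointly monic in $\mathsf{Kl}(T)$. -}

module Defs where

open import Level using (Level; _⊔_) renaming (suc to lsuc)
open import Data.Nat using (ℕ; zero; suc)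
open import Data.Fin using (Fin; zero; suc)
open import Data.Product using (Σ; _,_; proj₁)
open import Relation.Binary using (Rel; IsEquivalence)

record Category (o ℓ e : Level) : Set (lsuc (o ⊔ ℓ ⊔ e)) where
  infixr 9 _∘_
  infix  4 _≈_ _⇒_
  field
    Obj : Set o
    _⇒_ : Obj → Obj → Set ℓ
    _≈_ : ∀ {A B} → Rel (A ⇒ B) e
    id  : ∀ {A} → A ⇒ A
    _∘_ : ∀ {A B C} → B ⇒ C → A ⇒ B → A ⇒ C
    equiv     : ∀ {A B} → IsEquivalence (_≈_ {A} {B})
    ∘-resp-≈  : ∀ {A B C} {f h : B ⇒ C} {g i : A ⇒ B} → f ≈ h → g ≈ i → f ∘ g ≈ h ∘ i
    assoc     : ∀ {A B C D} {f : A ⇒ B} {g : B ⇒ C} {h : C ⇒ D} → (h ∘ g) ∘ f ≈ h ∘ (g ∘ f)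
    identityˡ : ∀ {A B} {f : A ⇒ B} → id ∘ f ≈ f
    identityʳ : ∀ {A B} {f : A ⇒ B} → f ∘ id ≈ f

record CartesianCategory (o ℓ e : Level) : Set (lsuc (o ⊔ ℓ ⊔ e)) where
  field
    category : Category o ℓ e
  open Category category public
  infixr 7 _×_
  field
    ⊤        : Obj
    !        : ∀ {A} → A ⇒ ⊤
    !-unique : ∀ {A} (f : A ⇒ ⊤) → f ≈ !
    _×_      : Obj → Obj → Obj
    π₁       : ∀ {A B} → A × B ⇒ A
    π₂       : ∀ {A B} → A × B ⇒ B
    ⟨_,_⟩    : ∀ {A B C} → C ⇒ A → C ⇒ B → C ⇒ A × B
    project₁ : ∀ {A B C} {f : C ⇒ A} {g : C ⇒ B} → π₁ ∘ ⟨ f , g ⟩ ≈ f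
    project₂ : ∀ {A B C} {f : C ⇒ A} {g : C ⇒ B} → π₂ ∘ ⟨ f , g ⟩ ≈ g
    unique   : ∀ {A B C} {h : C ⇒ A × B} {f : C ⇒ A} {g : C ⇒ B} →
               π₁ ∘ h ≈ f → π₂ ∘ h ≈ g → ⟨ f , g ⟩ ≈ h

  infixr 8 _⁂_
  _⁂_ : ∀ {A B C D} → A ⇒ B → C ⇒ D → A × C ⇒ B × D
  f ⁂ g = ⟨ f ∘ π₁ , g ∘ π₂ ⟩

  swap : ∀ {A B} → A × B ⇒ B × A
  swap = ⟨ π₂ , π₁ ⟩

  α⇒ : ∀ {A B C} → (A × B) × C ⇒ A × (B × C)
  α⇒ = ⟨ π₁ ∘ π₁ , ⟨ π₂ ∘ π₁ , π₂ ⟩ ⟩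

  pow : Obj → ℕ → Obj
  pow A zero          = ⊤
  pow A (suc zero)    = A
  pow A (suc (suc n)) = A × pow A (suc n)

  Δ : ∀ {A} (n : ℕ) → A ⇒ pow A n
  Δ zero          = !
  Δ (suc zero)    = id
  Δ (suc (suc n)) = ⟨ id , Δ (suc n) ⟩

  prodN : ∀ {A B} (n : ℕ) → (Fin n → A ⇒ B) → pow A n ⇒ pow B n
  prodN zero          g = id
  prodN (suc zero)    g = g zero
  prodN (suc (suc n)) g = g zero ⁂ prodN (suc n) (λ i → g (suc i))

record CommutativeMonad {o ℓ e} (C : CartesianCategory o ℓ e) : Set (o ⊔ ℓ ⊔ e) where
  open CartesianCategory C
  field
    T₀ : Obj → Obj
    T₁ : ∀ {A B} → A ⇒ B → T₀ A ⇒ T₀ B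
    T-identity : ∀ {A} → T₁ (id {A}) ≈ id
    T-homomorphism : ∀ {A B D} {f : A ⇒ B} {g : B ⇒ D} → T₁ (g ∘ f) ≈ T₁ g ∘ T₁ f
    T-resp-≈ : ∀ {A B} {f g : A ⇒ B} → f ≈ g → T₁ f ≈ T₁ g
    η : ∀ A → A ⇒ T₀ A
    μ : ∀ A → T₀ (T₀ A) ⇒ T₀ A
    η-natural : ∀ {A B} (f : A ⇒ B) → T₁ f ∘ η A ≈ η B ∘ f
    μ-natural : ∀ {A B} (f : A ⇒ B) → T₁ f ∘ μ A ≈ μ B ∘ T₁ (T₁ f)
    μ-assoc    : ∀ {A} → μ A ∘ T₁ (μ A) ≈ μ A ∘ μ (T₀ A)
    μ-identityˡ : ∀ {A} → μ A ∘ T₁ (η A) ≈ id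
    μ-identityʳ : ∀ {A} → μ A ∘ η (T₀ A) ≈ id
    t : ∀ A B → A × T₀ B ⇒ T₀ (A × B)
    t-natural : ∀ {A A′ B B′} (f : A ⇒ A′) (g : B ⇒ B′) →
                t A′ B′ ∘ (f ⁂ T₁ g) ≈ T₁ (f ⁂ g) ∘ t A B
    t-unit  : ∀ {B} → T₁ π₂ ∘ t ⊤ B ≈ π₂
    t-assoc : ∀ {A B D} →
              t A (B × D) ∘ (id ⁂ t B D) ∘ α⇒ ≈ T₁ α⇒ ∘ t (A × B) D
    t-η : ∀ {A B} → t A B ∘ (id ⁂ η B) ≈ η (A × B)
    t-μ : ∀ {A B} → t A B ∘ (id ⁂ μ B) ≈ μ (A × B) ∘ T₁ (t A B) ∘ t A (T₀ B)

  t′ : ∀ A B → T₀ A × B ⇒ T₀ (A × B)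
  t′ A B = T₁ swap ∘ t B A ∘ swap

  field
    commutative : ∀ {A B} →
      μ (A × B) ∘ T₁ (t′ A B) ∘ t (T₀ A) B ≈ μ (A × B) ∘ T₁ (t A B) ∘ t′ A (T₀ B)

  ∇ : ∀ A B → T₀ A × T₀ B ⇒ T₀ (A × B)
  ∇ A B = μ (A × B) ∘ T₁ (t′ A B) ∘ t (T₀ A) B

record MonoidObj {o ℓ e} (C : CartesianCategory o ℓ e) : Set (o ⊔ ℓ ⊔ e) where
  open CartesianCategory C
  field
    Carrier : Obj
    unit    : ⊤ ⇒ Carrier
    mult    : Carrier × Carrier ⇒ Carrier
    mult-assoc : mult ∘ (mult ⁂ id) ≈ mult ∘ (id ⁂ mult) ∘ α⇒
    identityˡ′ : mult ∘ ⟨ unit ∘ ! , id ⟩ ≈ id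
    identityʳ′ : mult ∘ ⟨ id , unit ∘ ! ⟩ ≈ id

module Setup {o ℓ e} (C : CartesianCategory o ℓ e) (M : CommutativeMonad C) where
  open CartesianCategory C
  open CommutativeMonad M

  JointlyMonic : ∀ {a} {I : Set a} {A : Obj} (B : I → Obj) →
                 ((i : I) → A ⇒ B i) → Set (o ⊔ ℓ ⊔ e ⊔ a)
  JointlyMonic {A = A} B f =
    ∀ {Z} (u v : Z ⇒ A) → (∀ i → f i ∘ u ≈ f i ∘ v) → u ≈ v

  -- Kleisli category Kl(T): a morphism A ⇝ B is represented by f♯ : A → TB.
  infix 4 _⇝_
  _⇝_ : Obj → Obj → Set ℓ
  A ⇝ B = A ⇒ T₀ B

  _⊚_ : ∀ {A B D} → B ⇝ D → A ⇝ B → A ⇝ D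
  _⊚_ {D = D} g f = μ D ∘ T₁ g ∘ f

  _⊗_ : ∀ {A B A′ B′} → A ⇝ B → A′ ⇝ B′ → (A × A′) ⇝ (B × B′)
  _⊗_ {B = B} {B′ = B′} f g = ∇ B B′ ∘ (f ⁂ g)

  kid : ∀ {A} → A ⇝ A
  kid {A} = η A

  ⊗N : ∀ {A B} (n : ℕ) → (Fin n → A ⇝ B) → pow A n ⇝ pow B n
  ⊗N zero          f = kid
  ⊗N (suc zero)    f = f zero
  ⊗N (suc (suc n)) f = f zero ⊗ ⊗N (suc n) (λ i → f (suc i))

  copy : ∀ {X} → X ⇝ (X × X)
  copy {X} = η (X × X) ∘ ⟨ id , id ⟩

  del : ∀ {X} → X ⇝ ⊤
  del = η ⊤ ∘ !

  copyN : ∀ {X} (n : ℕ) → X ⇝ pow X n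
  copyN zero          = del
  copyN (suc zero)    = kid
  copyN (suc (suc n)) = (kid ⊗ copyN (suc n)) ⊚ copy

  force : ∀ {X} → T₀ X ⇝ X
  force = id

  samp : ∀ {X} (n : ℕ) → T₀ X ⇝ pow X n
  samp n = ⊗N n (λ _ → force) ⊚ copyN n

  KlJointlyMonic : ∀ {a} {I : Set a} {A : Obj} (B : I → Obj) →
                   ((i : I) → A ⇝ B i) → Set (o ⊔ ℓ ⊔ e ⊔ a)
  KlJointlyMonic {A = A} B f =
    ∀ {Z} (u v : Z ⇝ A) → (∀ i → f i ⊚ u ≈ f i ⊚ v) → u ≈ v

  Observational : Set (o ⊔ ℓ ⊔ e)
  Observational = ∀ X → KlJointlyMonic {I = ℕ} {A = T₀ X} (pow X) samp

  module WithMonoid (R : MonoidObj C) where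
    open MonoidObj R renaming (Carrier to Rc; unit to eR; mult to mR)

    S : Obj
    S = T₀ Rc

    s : T₀ S ⇒ S
    s = μ Rc

    eS : ⊤ ⇒ S
    eS = T₁ eR ∘ η ⊤

    mS : S × S ⇒ S
    mS = T₁ mR ∘ ∇ Rc Rc

    mN : (n : ℕ) → pow S n ⇒ S
    mN zero          = eS
    mN (suc zero)    = id
    mN (suc (suc n)) = mS ∘ (id ⁂ mN (suc n))

    pointwise : ∀ {Y} (n : ℕ) → (Fin n → Y ⇒ S) → Y ⇒ S
    pointwise n g = mN n ∘ prodN n g ∘ Δ n

    ε : ∀ {X} → X ⇒ S → T₀ X ⇒ S
    ε h = s ∘ T₁ h

    Index : Obj → Set ℓ
    Index X = Σ ℕ (λ n → Fin n → X ⇒ S)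

    hypFamily : ∀ X → Index X → T₀ (T₀ X) ⇒ S
    hypFamily X (n , h) = s ∘ T₁ (pointwise n (λ i → ε (h i)))

    Hypothesis : Set (o ⊔ ℓ ⊔ e)
    Hypothesis = ∀ X → JointlyMonic {I = Index X} (λ _ → S) (hypFamily X)

    obsFamily : ∀ X → (i : Index X) → T₀ X ⇝ pow Rc (proj₁ i)
    obsFamily X (n , h) = ⊗N n h ⊚ samp n

    RObservational : Set (o ⊔ ℓ ⊔ e)
    RObservational = ∀ X →
      KlJointlyMonic {I = Index X} {A = T₀ X} (λ i → pow Rc (proj₁ i)) (obsFamily X)

{-# OPTIONS --safe #-}
-- Unfolding sampₙ through the iterated copy, the interchange law of ⊗ in Kl(T) (which is where
-- commutativity of T enters) and (a ⊗ b) ⊚ copy = ∇ ∘ ⟨ a , b ⟩ show that the R-observation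
-- (h₁♭ ⊗ ⋯ ⊗ hₙ♭) ⊚ sampₙ, pushed forward along T(mₙᴿ), is the pointwise product ε_{h₁} ⋯ ε_{hₙ}.
-- Hence s ∘ T(ε_{h₁} ⋯ ε_{hₙ}) is T(mₙᴿ) after the Kleisli extension of that observation, so two
-- Kleisli maps with the same R-observations are identified by the hypothesis family.
-- Observationality follows because every R-observation factors through sampₙ.
module Submission where

open import Level using (Level)
open import Data.Product using (_×_; _,_; proj₁; proj₂)
open import Data.Nat using (ℕ; zero; suc)
open import Data.Fin using (Fin; zero; suc)
open import Relation.Binary using (Setoid; IsEquivalence)
import Relation.Binary.Reasoning.Setoid as SetoidReasoning
open import Defs

module CartesianLemmas {o ℓ e} (C : CartesianCategory o ℓ e) where
  open CartesianCategory C

  module Hom {A B : Obj} = IsEquivalence (equiv {A} {B})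

  hom-setoid : Obj → Obj → Setoid ℓ e
  hom-setoid A B = record { Carrier = A ⇒ B ; _≈_ = _≈_ ; isEquivalence = equiv }

  open module HomReasoning {A B : Obj} = SetoidReasoning (hom-setoid A B)
    using (begin_; step-≈-⟩; step-≈-⟨; _∎) public

  infixr 4 _⟩∘⟨_ refl⟩∘⟨_
  infixl 5 _⟩∘⟨refl

  _⟩∘⟨_ : ∀ {A B D} {f h : B ⇒ D} {g i : A ⇒ B} → f ≈ h → g ≈ i → f ∘ g ≈ h ∘ i
  _⟩∘⟨_ = ∘-resp-≈

  refl⟩∘⟨_ : ∀ {A B D} {f : B ⇒ D} {g i : A ⇒ B} → g ≈ i → f ∘ g ≈ f ∘ i
  refl⟩∘⟨ q = ∘-resp-≈ Hom.refl q

  _⟩∘⟨refl : ∀ {A B D} {f h : B ⇒ D} {g : A ⇒ B} → f ≈ h → f ∘ g ≈ h ∘ g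
  p ⟩∘⟨refl = ∘-resp-≈ p Hom.refl

  sym-assoc : ∀ {A B D E} {f : A ⇒ B} {g : B ⇒ D} {h : D ⇒ E} → h ∘ (g ∘ f) ≈ (h ∘ g) ∘ f
  sym-assoc = Hom.sym assoc

  pullˡ : ∀ {A B D E} {f : D ⇒ E} {g : B ⇒ D} {h : B ⇒ E} {k : A ⇒ B} →
          f ∘ g ≈ h → f ∘ (g ∘ k) ≈ h ∘ k
  pullˡ p = Hom.trans sym-assoc (p ⟩∘⟨refl)

  pullʳ : ∀ {A B D E} {f : D ⇒ E} {g : B ⇒ D} {h : A ⇒ B} {k : A ⇒ D} →
          g ∘ h ≈ k → (f ∘ g) ∘ h ≈ f ∘ k
  pullʳ p = Hom.trans assoc (refl⟩∘⟨ p)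

  ⟨⟩-cong : ∀ {A B D} {f f′ : D ⇒ A} {g g′ : D ⇒ B} → f ≈ f′ → g ≈ g′ → ⟨ f , g ⟩ ≈ ⟨ f′ , g′ ⟩
  ⟨⟩-cong p q = unique (Hom.trans project₁ (Hom.sym p)) (Hom.trans project₂ (Hom.sym q))

  ⟨⟩∘ : ∀ {A B D E} {f : D ⇒ A} {g : D ⇒ B} {h : E ⇒ D} → ⟨ f , g ⟩ ∘ h ≈ ⟨ f ∘ h , g ∘ h ⟩
  ⟨⟩∘ = Hom.sym (unique (pullˡ project₁) (pullˡ project₂))

  ⟨π₁,π₂⟩≈id : ∀ {A B} → ⟨ π₁ {A} {B} , π₂ ⟩ ≈ id
  ⟨π₁,π₂⟩≈id = unique identityʳ identityʳ

  ⁂-cong : ∀ {A B A′ B′} {f f′ : A ⇒ A′} {g g′ : B ⇒ B′} → f ≈ f′ → g ≈ g′ → f ⁂ g ≈ f′ ⁂ g′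
  ⁂-cong p q = ⟨⟩-cong (p ⟩∘⟨refl) (q ⟩∘⟨refl)

  ⁂∘⟨⟩ : ∀ {A B A′ B′ D} {f : A ⇒ A′} {g : B ⇒ B′} {h : D ⇒ A} {k : D ⇒ B} →
         (f ⁂ g) ∘ ⟨ h , k ⟩ ≈ ⟨ f ∘ h , g ∘ k ⟩
  ⁂∘⟨⟩ = Hom.trans ⟨⟩∘ (⟨⟩-cong (pullʳ project₁) (pullʳ project₂))

  ⁂∘⁂ : ∀ {A B A′ B′ A″ B″} {f : A′ ⇒ A″} {g : B′ ⇒ B″} {h : A ⇒ A′} {k : B ⇒ B′} →
        (f ⁂ g) ∘ (h ⁂ k) ≈ (f ∘ h) ⁂ (g ∘ k)
  ⁂∘⁂ = Hom.trans ⁂∘⟨⟩ (⟨⟩-cong sym-assoc sym-assoc)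

  swap∘⁂ : ∀ {A B A′ B′} {f : A ⇒ A′} {g : B ⇒ B′} → swap ∘ (f ⁂ g) ≈ (g ⁂ f) ∘ swap
  swap∘⁂ = Hom.trans ⟨⟩∘ (Hom.trans (⟨⟩-cong project₂ project₁) (Hom.sym ⁂∘⟨⟩))

  swap∘swap : ∀ {A B} → swap {A} {B} ∘ swap ≈ id
  swap∘swap = Hom.trans ⟨⟩∘ (Hom.trans (⟨⟩-cong project₂ project₁) ⟨π₁,π₂⟩≈id)

module KleisliLemmas {o ℓ e} (C : CartesianCategory o ℓ e) (M : CommutativeMonad C) where
  open CartesianCategory C
  open CommutativeMonad M
  open Setup C M
  open CartesianLemmas C

  ⊚-resp-≈ : ∀ {A B D} {f f′ : B ⇝ D} {g g′ : A ⇝ B} → f ≈ f′ → g ≈ g′ → f ⊚ g ≈ f′ ⊚ g′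
  ⊚-resp-≈ p q = refl⟩∘⟨ T-resp-≈ p ⟩∘⟨ q

  ⊚-assoc : ∀ {A B D E} {f : D ⇝ E} {g : B ⇝ D} {h : A ⇝ B} → (f ⊚ g) ⊚ h ≈ f ⊚ (g ⊚ h)
  ⊚-assoc {D = D} {E} {f} {g} {h} = begin
    μ E ∘ T₁ (μ E ∘ T₁ f ∘ g) ∘ h              ≈⟨ refl⟩∘⟨ T₁-∘₃ ⟩∘⟨refl ⟩
    μ E ∘ (T₁ (μ E) ∘ T₁ (T₁ f) ∘ T₁ g) ∘ h    ≈⟨ refl⟩∘⟨ Hom.trans assoc (refl⟩∘⟨ assoc) ⟩
    μ E ∘ T₁ (μ E) ∘ T₁ (T₁ f) ∘ T₁ g ∘ h      ≈⟨ pullˡ μ-assoc ⟩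
    (μ E ∘ μ (T₀ E)) ∘ T₁ (T₁ f) ∘ T₁ g ∘ h    ≈⟨ pullʳ (pullˡ (Hom.sym (μ-natural f))) ⟩
    μ E ∘ (T₁ f ∘ μ D) ∘ T₁ g ∘ h              ≈⟨ refl⟩∘⟨ assoc ⟩
    μ E ∘ T₁ f ∘ μ D ∘ T₁ g ∘ h                ∎
    where
      T₁-∘₃ : T₁ (μ E ∘ T₁ f ∘ g) ≈ T₁ (μ E) ∘ T₁ (T₁ f) ∘ T₁ g
      T₁-∘₃ = Hom.trans T-homomorphism (refl⟩∘⟨ T-homomorphism)

  ⊚-identityˡ : ∀ {A B} {f : A ⇝ B} → kid ⊚ f ≈ f
  ⊚-identityˡ = Hom.trans (pullˡ μ-identityˡ) identityˡ

  ⊚-identityʳ : ∀ {A B} {f : A ⇝ B} → f ⊚ kid ≈ f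
  ⊚-identityʳ {f = f} = Hom.trans (refl⟩∘⟨ η-natural f) (Hom.trans (pullˡ μ-identityʳ) identityˡ)

  ⊚-pure : ∀ {A B D} {f : B ⇝ D} {g : A ⇒ B} → f ⊚ (η B ∘ g) ≈ f ∘ g
  ⊚-pure {B = B} {D} {f} {g} = begin
    μ D ∘ T₁ f ∘ η B ∘ g         ≈⟨ refl⟩∘⟨ pullˡ (η-natural f) ⟩
    μ D ∘ (η (T₀ D) ∘ f) ∘ g     ≈⟨ pullˡ (pullˡ μ-identityʳ) ⟩
    (id ∘ f) ∘ g                 ≈⟨ identityˡ ⟩∘⟨refl ⟩
    f ∘ g                        ∎

  ⊚-∘ : ∀ {A B D E} {f : B ⇝ D} {g : A ⇝ B} {h : E ⇒ A} → (f ⊚ g) ∘ h ≈ f ⊚ (g ∘ h)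
  ⊚-∘ = Hom.trans assoc (refl⟩∘⟨ assoc)

  ⊚-T₁ : ∀ {A B B′ D} {f : B′ ⇝ D} {k : B ⇒ B′} {g : A ⇝ B} → f ⊚ (T₁ k ∘ g) ≈ (f ∘ k) ⊚ g
  ⊚-T₁ = refl⟩∘⟨ pullˡ (Hom.sym T-homomorphism)

  T₁-⊚ : ∀ {A B B′ D} {k : B ⇒ B′} {f : D ⇝ B} {g : A ⇝ D} → (T₁ k ∘ f) ⊚ g ≈ T₁ k ∘ (f ⊚ g)
  T₁-⊚ {k = k} {f} {g} = begin
    μ _ ∘ T₁ (T₁ k ∘ f) ∘ g          ≈⟨ refl⟩∘⟨ T-homomorphism ⟩∘⟨refl ⟩
    μ _ ∘ (T₁ (T₁ k) ∘ T₁ f) ∘ g     ≈⟨ refl⟩∘⟨ assoc ⟩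
    μ _ ∘ T₁ (T₁ k) ∘ T₁ f ∘ g       ≈⟨ pullˡ (Hom.sym (μ-natural k)) ⟩
    (T₁ k ∘ μ _) ∘ T₁ f ∘ g          ≈⟨ assoc ⟩
    T₁ k ∘ μ _ ∘ T₁ f ∘ g            ∎

  t′-natural : ∀ {A A′ B B′} (f : A ⇒ A′) (g : B ⇒ B′) →
               t′ A′ B′ ∘ (T₁ f ⁂ g) ≈ T₁ (f ⁂ g) ∘ t′ A B
  t′-natural {A} {A′} {B} {B′} f g = begin
    t′ A′ B′ ∘ (T₁ f ⁂ g)                    ≈⟨ pullʳ assoc ⟩
    T₁ swap ∘ t B′ A′ ∘ swap ∘ (T₁ f ⁂ g)    ≈⟨ refl⟩∘⟨ refl⟩∘⟨ swap∘⁂ ⟩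
    T₁ swap ∘ t B′ A′ ∘ (g ⁂ T₁ f) ∘ swap    ≈⟨ refl⟩∘⟨ pullˡ (t-natural g f) ⟩
    T₁ swap ∘ (T₁ (g ⁂ f) ∘ t B A) ∘ swap    ≈⟨ pullˡ (pullˡ (Hom.sym T-homomorphism)) ⟩
    (T₁ (swap ∘ (g ⁂ f)) ∘ t B A) ∘ swap     ≈⟨ T-resp-≈ swap∘⁂ ⟩∘⟨refl ⟩∘⟨refl ⟩
    (T₁ ((f ⁂ g) ∘ swap) ∘ t B A) ∘ swap     ≈⟨ T-homomorphism ⟩∘⟨refl ⟩∘⟨refl ⟩
    ((T₁ (f ⁂ g) ∘ T₁ swap) ∘ t B A) ∘ swap  ≈⟨ Hom.trans assoc assoc ⟩
    T₁ (f ⁂ g) ∘ T₁ swap ∘ t B A ∘ swap      ∎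

  t′∘swap : ∀ {A B} → t′ A B ∘ swap ≈ T₁ swap ∘ t B A
  t′∘swap = Hom.trans (pullʳ (pullʳ swap∘swap)) (refl⟩∘⟨ identityʳ)

  t′-μ : ∀ {A B} → t′ A B ∘ (μ A ⁂ id) ≈ t′ A B ⊚ t′ (T₀ A) B
  t′-μ {A} {B} = begin
    t′ A B ∘ (μ A ⁂ id)                                 ≈⟨ pullʳ assoc ⟩
    T₁ swap ∘ t B A ∘ swap ∘ (μ A ⁂ id)                 ≈⟨ refl⟩∘⟨ refl⟩∘⟨ swap∘⁂ ⟩
    T₁ swap ∘ t B A ∘ (id ⁂ μ A) ∘ swap                 ≈⟨ refl⟩∘⟨ pullˡ t-μ ⟩
    T₁ swap ∘ (t B A ⊚ t B (T₀ A)) ∘ swap               ≈⟨ refl⟩∘⟨ ⊚-∘ ⟩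
    T₁ swap ∘ (t B A ⊚ (t B (T₀ A) ∘ swap))             ≈⟨ T₁-⊚ ⟨
    (T₁ swap ∘ t B A) ⊚ (t B (T₀ A) ∘ swap)             ≈⟨ ⊚-resp-≈ t′∘swap Hom.refl ⟨
    (t′ A B ∘ swap) ⊚ (t B (T₀ A) ∘ swap)               ≈⟨ ⊚-T₁ ⟨
    t′ A B ⊚ t′ (T₀ A) B                                ∎

  ∇-natural : ∀ {A A′ B B′} (f : A ⇒ A′) (g : B ⇒ B′) → ∇ A′ B′ ∘ (T₁ f ⁂ T₁ g) ≈ T₁ (f ⁂ g) ∘ ∇ A B
  ∇-natural {A} {A′} {B} {B′} f g = begin
    (t′ A′ B′ ⊚ t (T₀ A′) B′) ∘ (T₁ f ⁂ T₁ g)    ≈⟨ ⊚-∘ ⟩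
    t′ A′ B′ ⊚ (t (T₀ A′) B′ ∘ (T₁ f ⁂ T₁ g))    ≈⟨ ⊚-resp-≈ Hom.refl (t-natural (T₁ f) g) ⟩
    t′ A′ B′ ⊚ (T₁ (T₁ f ⁂ g) ∘ t (T₀ A) B)      ≈⟨ ⊚-T₁ ⟩
    (t′ A′ B′ ∘ (T₁ f ⁂ g)) ⊚ t (T₀ A) B         ≈⟨ ⊚-resp-≈ (t′-natural f g) Hom.refl ⟩
    (T₁ (f ⁂ g) ∘ t′ A B) ⊚ t (T₀ A) B           ≈⟨ T₁-⊚ ⟩
    T₁ (f ⁂ g) ∘ ∇ A B                           ∎

  ∇-naturalʳ : ∀ {A B B′} (g : B ⇒ B′) → ∇ A B′ ∘ (id ⁂ T₁ g) ≈ T₁ (id ⁂ g) ∘ ∇ A B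
  ∇-naturalʳ g = Hom.trans (refl⟩∘⟨ ⁂-cong (Hom.sym T-identity) Hom.refl) (∇-natural id g)

  ∇∘μ⁂id : ∀ {A B} → ∇ A B ∘ (μ A ⁂ id) ≈ t′ A B ⊚ ∇ (T₀ A) B
  ∇∘μ⁂id {A} {B} = begin
    (t′ A B ⊚ t (T₀ A) B) ∘ (μ A ⁂ id)           ≈⟨ ⊚-∘ ⟩
    t′ A B ⊚ (t (T₀ A) B ∘ (μ A ⁂ id))           ≈⟨ ⊚-resp-≈ Hom.refl (refl⟩∘⟨ ⁂-cong Hom.refl (Hom.sym T-identity)) ⟩
    t′ A B ⊚ (t (T₀ A) B ∘ (μ A ⁂ T₁ id))        ≈⟨ ⊚-resp-≈ Hom.refl (t-natural (μ A) id) ⟩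
    t′ A B ⊚ (T₁ (μ A ⁂ id) ∘ t (T₀ (T₀ A)) B)   ≈⟨ ⊚-T₁ ⟩
    (t′ A B ∘ (μ A ⁂ id)) ⊚ t (T₀ (T₀ A)) B      ≈⟨ ⊚-resp-≈ t′-μ Hom.refl ⟩
    (t′ A B ⊚ t′ (T₀ A) B) ⊚ t (T₀ (T₀ A)) B     ≈⟨ ⊚-assoc ⟩
    t′ A B ⊚ ∇ (T₀ A) B                          ∎

  ∇∘id⁂μ : ∀ {A B} → ∇ A B ∘ (id ⁂ μ B) ≈ t A B ⊚ ∇ A (T₀ B)
  ∇∘id⁂μ {A} {B} = begin
    ∇ A B ∘ (id ⁂ μ B)                           ≈⟨ commutative ⟩∘⟨refl ⟩
    (t A B ⊚ t′ A (T₀ B)) ∘ (id ⁂ μ B)           ≈⟨ ⊚-∘ ⟩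
    t A B ⊚ (t′ A (T₀ B) ∘ (id ⁂ μ B))           ≈⟨ ⊚-resp-≈ Hom.refl (refl⟩∘⟨ ⁂-cong (Hom.sym T-identity) Hom.refl) ⟩
    t A B ⊚ (t′ A (T₀ B) ∘ (T₁ id ⁂ μ B))        ≈⟨ ⊚-resp-≈ Hom.refl (t′-natural id (μ B)) ⟩
    t A B ⊚ (T₁ (id ⁂ μ B) ∘ t′ A (T₀ (T₀ B)))   ≈⟨ ⊚-T₁ ⟩
    (t A B ∘ (id ⁂ μ B)) ⊚ t′ A (T₀ (T₀ B))      ≈⟨ ⊚-resp-≈ t-μ Hom.refl ⟩
    (t A B ⊚ t A (T₀ B)) ⊚ t′ A (T₀ (T₀ B))      ≈⟨ ⊚-assoc ⟩
    t A B ⊚ (t A (T₀ B) ⊚ t′ A (T₀ (T₀ B)))      ≈⟨ ⊚-resp-≈ Hom.refl commutative ⟨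
    t A B ⊚ ∇ A (T₀ B)                           ∎

  ∇-μ : ∀ {A B} → ∇ A B ∘ (μ A ⁂ μ B) ≈ ∇ A B ⊚ ∇ (T₀ A) (T₀ B)
  ∇-μ {A} {B} = begin
    ∇ A B ∘ (μ A ⁂ μ B)                          ≈⟨ refl⟩∘⟨ μ⁂μ≈μ⁂id∘id⁂μ ⟩
    ∇ A B ∘ (μ A ⁂ id) ∘ (id ⁂ μ B)              ≈⟨ pullˡ ∇∘μ⁂id ⟩
    (t′ A B ⊚ ∇ (T₀ A) B) ∘ (id ⁂ μ B)           ≈⟨ ⊚-∘ ⟩
    t′ A B ⊚ (∇ (T₀ A) B ∘ (id ⁂ μ B))           ≈⟨ ⊚-resp-≈ Hom.refl ∇∘id⁂μ ⟩
    t′ A B ⊚ (t (T₀ A) B ⊚ ∇ (T₀ A) (T₀ B))      ≈⟨ ⊚-assoc ⟨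
    ∇ A B ⊚ ∇ (T₀ A) (T₀ B)                      ∎
    where
      μ⁂μ≈μ⁂id∘id⁂μ : μ A ⁂ μ B ≈ (μ A ⁂ id) ∘ (id ⁂ μ B)
      μ⁂μ≈μ⁂id∘id⁂μ = Hom.sym (Hom.trans ⁂∘⁂ (⁂-cong identityʳ identityˡ))

  ⊗-interchange : ∀ {A A′ B B′ D D′} {f : B ⇝ D} {g : B′ ⇝ D′} {f′ : A ⇝ B} {g′ : A′ ⇝ B′} →
                  (f ⊗ g) ⊚ (f′ ⊗ g′) ≈ (f ⊚ f′) ⊗ (g ⊚ g′)
  ⊗-interchange {A} {A′} {B} {B′} {D} {D′} {f} {g} {f′} {g′} = begin
    (∇ D D′ ∘ (f ⁂ g)) ⊚ (∇ B B′ ∘ (f′ ⁂ g′))                      ≈⟨ ⊚-T₁ ⟨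
    ∇ D D′ ⊚ (T₁ (f ⁂ g) ∘ ∇ B B′ ∘ (f′ ⁂ g′))                     ≈⟨ ⊚-resp-≈ Hom.refl (pullˡ (Hom.sym (∇-natural f g))) ⟩
    ∇ D D′ ⊚ ((∇ (T₀ D) (T₀ D′) ∘ (T₁ f ⁂ T₁ g)) ∘ (f′ ⁂ g′))      ≈⟨ ⊚-resp-≈ Hom.refl assoc ⟩
    ∇ D D′ ⊚ (∇ (T₀ D) (T₀ D′) ∘ (T₁ f ⁂ T₁ g) ∘ (f′ ⁂ g′))        ≈⟨ ⊚-∘ ⟨
    (∇ D D′ ⊚ ∇ (T₀ D) (T₀ D′)) ∘ (T₁ f ⁂ T₁ g) ∘ (f′ ⁂ g′)        ≈⟨ ∇-μ ⟩∘⟨refl ⟨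
    (∇ D D′ ∘ (μ D ⁂ μ D′)) ∘ (T₁ f ⁂ T₁ g) ∘ (f′ ⁂ g′)            ≈⟨ pullʳ (Hom.trans (refl⟩∘⟨ ⁂∘⁂) ⁂∘⁂) ⟩
    ∇ D D′ ∘ ((f ⊚ f′) ⁂ (g ⊚ g′))                                 ∎

  ⊗-copy : ∀ {X B D} {f : X ⇝ B} {g : X ⇝ D} → (f ⊗ g) ⊚ copy ≈ ∇ B D ∘ ⟨ f , g ⟩
  ⊗-copy = Hom.trans ⊚-pure (pullʳ (Hom.trans ⁂∘⟨⟩ (⟨⟩-cong identityʳ identityʳ)))

  KlJointlyMonic-fromFactors : ∀ {a b} {I : Set a} {J : Set b} {A : Obj} {B : I → Obj} {D : J → Obj}
    (f : (i : I) → A ⇝ B i) (p : J → I) (k : (j : J) → B (p j) ⇝ D j) →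
    KlJointlyMonic D (λ j → k j ⊚ f (p j)) → KlJointlyMonic B f
  KlJointlyMonic-fromFactors f p k mono u v f∘u≈f∘v = mono u v λ j → begin
    (k j ⊚ f (p j)) ⊚ u    ≈⟨ ⊚-assoc ⟩
    k j ⊚ (f (p j) ⊚ u)    ≈⟨ ⊚-resp-≈ Hom.refl (f∘u≈f∘v (p j)) ⟩
    k j ⊚ (f (p j) ⊚ v)    ≈⟨ ⊚-assoc ⟨
    (k j ⊚ f (p j)) ⊚ v    ∎

  KlJointlyMonic-fromExtensions : ∀ {a} {I : Set a} {A : Obj} {B D : I → Obj}
    (f : (i : I) → T₀ A ⇒ D i) (g : (i : I) → A ⇝ B i) (k : (i : I) → T₀ (B i) ⇒ D i) →
    (∀ i → f i ≈ k i ∘ μ (B i) ∘ T₁ (g i)) →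
    JointlyMonic D f → KlJointlyMonic B g
  KlJointlyMonic-fromExtensions {B = B} f g k f≈k∘g* mono u v g∘u≈g∘v = mono u v λ i → begin
    f i ∘ u                              ≈⟨ f≈k∘g* i ⟩∘⟨refl ⟩
    (k i ∘ μ (B i) ∘ T₁ (g i)) ∘ u       ≈⟨ pullʳ assoc ⟩
    k i ∘ (g i ⊚ u)                      ≈⟨ refl⟩∘⟨ g∘u≈g∘v i ⟩
    k i ∘ (g i ⊚ v)                      ≈⟨ pullʳ assoc ⟨
    (k i ∘ μ (B i) ∘ T₁ (g i)) ∘ v       ≈⟨ f≈k∘g* i ⟩∘⟨refl ⟨
    f i ∘ v                              ∎

module Observations {o ℓ e} (C : CartesianCategory o ℓ e) (M : CommutativeMonad C) (R : MonoidObj C) where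
  open CartesianCategory C
  open CommutativeMonad M
  open Setup C M
  open Setup.WithMonoid C M R
  open MonoidObj R using () renaming (Carrier to Rc; unit to eR; mult to mR)
  open CartesianLemmas C
  open KleisliLemmas C M

  multᴿ : (n : ℕ) → pow Rc n ⇒ Rc
  multᴿ zero          = eR
  multᴿ (suc zero)    = id
  multᴿ (suc (suc n)) = mR ∘ (id ⁂ multᴿ (suc n))

  ⊚-force : ∀ {X} {h : X ⇒ S} → h ⊚ (force ⊚ kid) ≈ ε h
  ⊚-force = Hom.trans (⊚-resp-≈ Hom.refl ⊚-identityʳ) (refl⟩∘⟨ identityʳ)

  obsFamily-suc : ∀ {X} n (h : Fin (suc (suc n)) → X ⇒ S) →
    obsFamily X (suc (suc n) , h) ≈ ∇ Rc (pow Rc (suc n)) ∘ ⟨ ε (h zero) , obsFamily X (suc n , λ i → h (suc i)) ⟩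
  obsFamily-suc {X} n h = begin
    (h zero ⊗ hs) ⊚ ((force ⊗ forces) ⊚ ((kid ⊗ copyN (suc n)) ⊚ copy))   ≈⟨ ⊚-resp-≈ Hom.refl ⊚-assoc ⟨
    (h zero ⊗ hs) ⊚ (((force ⊗ forces) ⊚ (kid ⊗ copyN (suc n))) ⊚ copy)   ≈⟨ ⊚-resp-≈ Hom.refl (⊚-resp-≈ ⊗-interchange Hom.refl) ⟩
    (h zero ⊗ hs) ⊚ (((force ⊚ kid) ⊗ samp (suc n)) ⊚ copy)              ≈⟨ ⊚-assoc ⟨
    ((h zero ⊗ hs) ⊚ ((force ⊚ kid) ⊗ samp (suc n))) ⊚ copy              ≈⟨ ⊚-resp-≈ ⊗-interchange Hom.refl ⟩
    ((h zero ⊚ (force ⊚ kid)) ⊗ (hs ⊚ samp (suc n))) ⊚ copy              ≈⟨ ⊗-copy ⟩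
    ∇ Rc (pow Rc (suc n)) ∘ ⟨ h zero ⊚ (force ⊚ kid) , hs ⊚ samp (suc n) ⟩ ≈⟨ refl⟩∘⟨ ⟨⟩-cong ⊚-force Hom.refl ⟩
    ∇ Rc (pow Rc (suc n)) ∘ ⟨ ε (h zero) , obsFamily X (suc n , λ i → h (suc i)) ⟩ ∎
    where
      hs : pow X (suc n) ⇝ pow Rc (suc n)
      hs = ⊗N (suc n) (λ i → h (suc i))
      forces : pow (T₀ X) (suc n) ⇝ pow X (suc n)
      forces = ⊗N (suc n) (λ _ → force)

  pointwise-suc : ∀ {Y} n (g : Fin (suc (suc n)) → Y ⇒ S) →
    pointwise (suc (suc n)) g ≈ mS ∘ ⟨ g zero , pointwise (suc n) (λ i → g (suc i)) ⟩
  pointwise-suc n g =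
    pullʳ (Hom.trans (refl⟩∘⟨ ⁂∘⟨⟩) (Hom.trans ⁂∘⟨⟩ (⟨⟩-cong (Hom.trans identityˡ identityʳ) Hom.refl)))

  multᴿ∘obsFamily≈pointwise : ∀ {X} n (h : Fin n → X ⇒ S) →
    T₁ (multᴿ n) ∘ obsFamily X (n , h) ≈ pointwise n (λ i → ε (h i))
  multᴿ∘obsFamily≈pointwise zero h = begin
    T₁ eR ∘ (kid ⊚ (kid ⊚ del))      ≈⟨ refl⟩∘⟨ Hom.trans ⊚-identityˡ ⊚-identityˡ ⟩
    T₁ eR ∘ η ⊤ ∘ !                  ≈⟨ sym-assoc ⟩
    eS ∘ !                           ≈⟨ refl⟩∘⟨ identityˡ ⟨
    eS ∘ id ∘ !                      ∎
  multᴿ∘obsFamily≈pointwise (suc zero) h = begin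
    T₁ id ∘ (h zero ⊚ (force ⊚ kid))  ≈⟨ T-identity ⟩∘⟨ ⊚-force ⟩
    id ∘ ε (h zero)                   ≈⟨ refl⟩∘⟨ identityʳ ⟨
    id ∘ ε (h zero) ∘ id              ∎
  multᴿ∘obsFamily≈pointwise {X} (suc (suc n)) h = begin
    T₁ (mR ∘ (id ⁂ multᴿ (suc n))) ∘ obsFamily X (suc (suc n) , h)
      ≈⟨ T-homomorphism ⟩∘⟨ obsFamily-suc n h ⟩
    (T₁ mR ∘ T₁ (id ⁂ multᴿ (suc n))) ∘ ∇ Rc (pow Rc (suc n)) ∘ ⟨ ε (h zero) , obs ⟩
      ≈⟨ pullʳ (pullˡ (Hom.sym (∇-naturalʳ (multᴿ (suc n))))) ⟩
    T₁ mR ∘ (∇ Rc Rc ∘ (id ⁂ T₁ (multᴿ (suc n)))) ∘ ⟨ ε (h zero) , obs ⟩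
      ≈⟨ refl⟩∘⟨ pullʳ (Hom.trans ⁂∘⟨⟩ (⟨⟩-cong identityˡ (multᴿ∘obsFamily≈pointwise (suc n) (λ i → h (suc i))))) ⟩
    T₁ mR ∘ ∇ Rc Rc ∘ ⟨ ε (h zero) , pw ⟩
      ≈⟨ sym-assoc ⟩
    mS ∘ ⟨ ε (h zero) , pw ⟩
      ≈⟨ pointwise-suc n (λ i → ε (h i)) ⟨
    pointwise (suc (suc n)) (λ i → ε (h i))
      ∎
    where
      obs : T₀ X ⇒ T₀ (pow Rc (suc n))
      obs = obsFamily X (suc n , λ i → h (suc i))
      pw : T₀ X ⇒ S
      pw = pointwise (suc n) (λ i → ε (h (suc i)))

  hypFamily≈extension : ∀ {X} (i : Index X) →
    hypFamily X i ≈ T₁ (multᴿ (proj₁ i)) ∘ μ (pow Rc (proj₁ i)) ∘ T₁ (obsFamily X i)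
  hypFamily≈extension {X} (n , h) = begin
    μ Rc ∘ T₁ (pointwise n (λ i → ε (h i)))                    ≈⟨ refl⟩∘⟨ T-resp-≈ (multᴿ∘obsFamily≈pointwise n h) ⟨
    μ Rc ∘ T₁ (T₁ (multᴿ n) ∘ obsFamily X (n , h))             ≈⟨ refl⟩∘⟨ T-homomorphism ⟩
    μ Rc ∘ T₁ (T₁ (multᴿ n)) ∘ T₁ (obsFamily X (n , h))        ≈⟨ pullˡ (Hom.sym (μ-natural (multᴿ n))) ⟩
    (T₁ (multᴿ n) ∘ μ (pow Rc n)) ∘ T₁ (obsFamily X (n , h))   ≈⟨ assoc ⟩
    T₁ (multᴿ n) ∘ μ (pow Rc n) ∘ T₁ (obsFamily X (n , h))     ∎

  hypothesis⇒RObservational : Hypothesis → RObservational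
  hypothesis⇒RObservational hyp X =
    KlJointlyMonic-fromExtensions (hypFamily X) (obsFamily X) (λ i → T₁ (multᴿ (proj₁ i)))
      hypFamily≈extension (hyp X)

  RObservational⇒Observational : RObservational → Observational
  RObservational⇒Observational robs X =
    KlJointlyMonic-fromFactors samp proj₁ (λ i → ⊗N (proj₁ i) (proj₂ i)) (robs X)

lemma6p6 : ∀ {o ℓ e : Level} (C : CartesianCategory o ℓ e) (M : CommutativeMonad C) (R : MonoidObj C) →
    Setup.WithMonoid.Hypothesis C M R →
    Setup.WithMonoid.RObservational C M R × Setup.Observational C M
lemma6p6 C M R hyp = robs , RObservational⇒Observational robs
  where
    open Observations C M R
    robs : Setup.WithMonoid.RObservational C M R
    robs = hypothesis⇒RObservational hyp
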